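{- For every $n\ge 1$, the map $\varrho$ is a bijection from the set of compositions of $n$ onto $\mathcal{DRS}_n(231)$.
   Context: For $\sigma\in\mathfrak{S}_n$, a double descent is an index $i$ with $\sigma_i>\sigma_{i+1}>\sigma_{i+2}$. The permutation $\sigma$ is simsun if for every $k$, the subword of $\sigma$ consisting of the letters in $\{1,\dots,k\}$ (in the order they appear in $\sigma$) has no double descent. $\mathcal{DRS}_n(231)$ is the set of simsun $\sigma\in\mathfrak{S}_n$ containing no indices $i_1<i_2<i_3$ with $\sigma_{i_3}<\sigma_{i_1}<\sigma_{i_2}$ and such that $\sigma^{ -1}$ is simsun. For a composition $C=(t_1,\dots,t_j)$ of $n$, let $s_0=0$ and $s_i=t_1+\cdots+t_i$. Split $12\cdots n$ into blocks $\mu_i=(s_{i-1}+1)\cdots s_i$, and let $\overline{\mu}_i=s_i\,(s_{i-1}+1)\cdots(s_i-1)$ be $\mu_i$ with its last letter moved to the beginning. Define $\varrho(C)=\overline{\mu}_1\overline{\mu}_2\cdots\overline{\mu}_j\in\mathfrak{S}_n$ (concatenation). -}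

module Defs where

open import Data.Nat using (ℕ; zero; suc; _+_; _<_; _≤_; _≤?_; _≡ᵇ_)
open import Data.Bool using (if_then_else_)
open import Data.List using (List; []; _∷_; _++_; applyUpTo; filter)
open import Data.Nat.ListAction using (sum)
open import Relation.Binary.PropositionalEquality using (_≡_)
open import Data.List.Relation.Unary.All using (All)
open import Data.List.Relation.Binary.Permutation.Propositional using (_↭_)
open import Data.List.Relation.Binary.Sublist.Propositional using (_⊆_)
open import Data.Product using (_×_; ∃-syntax)
open import Relation.Nullary using (¬_)

-- Words / permutations are lists of naturals in one-line notation.

[1‥_] : ℕ → List ℕ
[1‥ n ] = applyUpTo suc n

IsPerm : ℕ → List ℕ → Set
IsPerm n σ = σ ↭ [1‥ n ]

data HasDD : List ℕ → Set where
  here  : ∀ {a b c w} → b < a → c < b → HasDD (a ∷ b ∷ c ∷ w)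
  there : ∀ {x w} → HasDD w → HasDD (x ∷ w)

Simsun : List ℕ → Set
Simsun σ = ∀ k → ¬ HasDD (filter (_≤? k) σ)

-- σ contains 231: indices i₁<i₂<i₃ with σ_{i₃} < σ_{i₁} < σ_{i₂}
-- (the subsequence σ_{i₁} σ_{i₂} σ_{i₃} is an order-preserving sublist)
Contains231 : List ℕ → Set
Contains231 σ = ∃[ a ] ∃[ b ] ∃[ c ] ((a ∷ b ∷ c ∷ []) ⊆ σ × c < a × a < b)

-- 0-based position of the letter v in a word
pos : ℕ → List ℕ → ℕ
pos v []       = zero
pos v (x ∷ xs) = if v ≡ᵇ x then zero else suc (pos v xs)

-- inverse of a permutation σ ∈ 𝔖ₙ in one-line notation: σ⁻¹(v) = position of v in σ (1-based)
inv : ℕ → List ℕ → List ℕ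
inv n σ = applyUpTo (λ i → suc (pos (suc i) σ)) n

DRS231 : ℕ → List ℕ → Set
DRS231 n σ = IsPerm n σ × Simsun σ × ¬ Contains231 σ × Simsun (inv n σ)

IsComposition : ℕ → List ℕ → Set
IsComposition n C = All (0 <_) C × sum C ≡ n

blockBar : ℕ → ℕ → List ℕ
blockBar s zero    = []
blockBar s (suc t) = (s + suc t) ∷ applyUpTo (λ i → s + suc i) t

-- ϱ with offset s (the number of letters used so far)
ϱ-from : ℕ → List ℕ → List ℕ
ϱ-from s []       = []
ϱ-from s (t ∷ ts) = blockBar s t ++ ϱ-from (s + t) ts

ϱ : List ℕ → List ℕ
ϱ C = ϱ-from 0 C

-- Both ϱ(C) and its inverse are block words: concatenations of blocks occupying consecutive
-- intervals of letters, the blocks of ϱ(C) being μ̄ = (s+t) (s+1) … (s+t−1) and those of ϱ(C)⁻¹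
-- being (s+2) … (s+t) (s+1).  The module BlockWords shows that a block word avoids 231 and
-- double descents as soon as each block does, and that cutting it at a height k (keeping the
-- letters ≤ k) gives again a block word; hence it is simsun.  Reading off positions gives
-- ϱ(C)⁻¹ = ψ(C), the block word of inverse blocks, so ϱ(C) ∈ 𝒟ℛ𝒮ₙ(231).  Injectivity holds
-- because the first letter of ϱ(C) determines the first part of C.  For surjectivity, peel
-- blocks off σ ∈ 𝒟ℛ𝒮ₙ(231): if the remaining suffix of σ rearranges s+1, …, s+p and begins
-- with m, then s+1, …, m−1 must follow m in this order.  Otherwise either a 231 appears, or
-- some y+1 precedes y with all letters strictly between y+1 and m after y, and cutting σ⁻¹ at
-- σ⁻¹(y) leaves the double descent σ⁻¹(y) σ⁻¹(y+1) σ⁻¹(m).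

module Submission where

open import Defs
open import Data.Nat
open import Data.Nat.Properties
open import Data.Nat.ListAction using (sum)
open import Data.Nat.Induction using (<-rec)
open import Data.Bool using (true; false; T)
open import Data.List using (List; []; _∷_; _++_; [_]; map; filter; length; applyUpTo; replicate)
open import Data.List.Properties
  using (map-++; map-id; map-cong-local; ++-assoc; ++-identityʳ; ++-cancelˡ; ∷-injective; length-++;
         filter-++; filter-all; filter-none; filter-accept; filter-reject)
open import Data.List.Relation.Unary.All as All using (All; []; _∷_)
open import Data.List.Relation.Unary.All.Properties using (++⁺; map⁺)
open import Data.List.Relation.Unary.Any using (here; there)
open import Data.List.Relation.Unary.Linked as Linked using (Linked; []; [-]; _∷_)
open import Data.List.Membership.Propositional using (_∈_)
open import Data.List.Membership.Propositional.Properties using (∈-++⁺ˡ; ∈-++⁺ʳ; ∈-++⁻)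
open import Data.List.Relation.Binary.Sublist.Propositional using (_⊆_; []; _∷_; _∷ʳ_; to∈; from∈; minimum; lookup)
open import Data.List.Relation.Binary.Sublist.Propositional.Properties using () renaming (++⁺ to ⊆-++⁺; ++⁺ˡ to ⊆-++ˡ)
open import Data.List.Relation.Binary.Permutation.Propositional using (_↭_; ↭-sym; ↭-trans; ↭-reflexive)
open import Data.List.Relation.Binary.Permutation.Propositional.Properties
  using (∈-resp-↭; ↭-length; drop-mid; drop-∷; ∷↭∷ʳ) renaming (++⁺ to ↭-++⁺)
open import Data.Product using (∃₂; ∃-syntax; _×_; _,_; proj₁; proj₂)
open import Data.Sum using (_⊎_; inj₁; inj₂; map₁)
open import Data.Empty using (⊥; ⊥-elim)
open import Function using (_∘_)
open import Relation.Nullary using (¬_; Dec; yes; no)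
open import Relation.Binary.PropositionalEquality hiding ([_])
open ≡-Reasoning

run : ℕ → ℕ → List ℕ
run s zero    = []
run s (suc q) = suc s ∷ run (suc s) q

applyUpTo-run : ∀ (g f : ℕ → ℕ) s q → (∀ i → g i ≡ f (s + suc i)) → applyUpTo g q ≡ map f (run s q)
applyUpTo-run g f s zero    g≗f = refl
applyUpTo-run g f s (suc q) g≗f =
  cong₂ _∷_ (trans (g≗f 0) (cong f (+-comm s 1)))
            (applyUpTo-run (g ∘ suc) f (suc s) q (λ i → trans (g≗f (suc i)) (cong f (+-suc s (suc i)))))

[1‥n]≡run : ∀ n → [1‥ n ] ≡ run 0 n
[1‥n]≡run n = trans (applyUpTo-run suc (λ v → v) 0 n (λ i → refl)) (map-id (run 0 n))

length-run : ∀ s q → length (run s q) ≡ q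
length-run s zero    = refl
length-run s (suc q) = cong suc (length-run (suc s) q)

run-++ : ∀ s p q → run s (p + q) ≡ run s p ++ run (s + p) q
run-++ s zero    q = cong (λ z → run z q) (sym (+-identityʳ s))
run-++ s (suc p) q = cong (suc s ∷_) (trans (run-++ (suc s) p q) (cong (λ z → run (suc s) p ++ run z q) (sym (+-suc s p))))

run-snoc : ∀ s q → run s (suc q) ≡ run s q ++ [ suc (s + q) ]
run-snoc s q = trans (cong (run s) (+-comm 1 q)) (run-++ s q 1)

All-run : ∀ {P : ℕ → Set} s q → (∀ {v} → s < v → v ≤ s + q → P v) → All P (run s q)
All-run s zero    P-range = []
All-run s (suc q) P-range =
  P-range ≤-refl (≤-trans (s≤s (m≤m+n s q)) (≤-reflexive (sym (+-suc s q))))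
  ∷ All-run (suc s) q (λ s<v v≤ → P-range (<⇒≤ s<v) (≤-trans v≤ (≤-reflexive (sym (+-suc s q)))))

∈-run⁻ : ∀ {v} s q → v ∈ run s q → s < v × v ≤ s + q
∈-run⁻ s q v∈ = All.lookup (All-run s q (λ s<v v≤ → s<v , v≤)) v∈

∈-run⁺ : ∀ {v} s q → s < v → v ≤ s + q → v ∈ run s q
∈-run⁺ s zero    s<v v≤s+0 = ⊥-elim (<⇒≱ s<v (≤-trans v≤s+0 (≤-reflexive (+-identityʳ s))))
∈-run⁺ {v} s (suc q) s<v v≤ with suc s ≟ v
... | yes refl = here refl
... | no s+1≢v = there (∈-run⁺ (suc s) q (≤∧≢⇒< s<v s+1≢v) (≤-trans v≤ (≤-reflexive (+-suc s q))))

run-split : ∀ {v} s q → v ∈ run s q →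
  ∃₂ λ i r → v ≡ s + suc i × q ≡ suc (i + r) × run s q ≡ run s i ++ v ∷ run v r
run-split {v} s q v∈ with ∈-run⁻ s q v∈
... | s<v , v≤s+q with m≤n⇒∃[o]m+o≡n s<v | m≤n⇒∃[o]m+o≡n v≤s+q
... | i , refl | r , v+r≡s+q = i , r , sym (+-suc s i) , q≡ , (begin
    run s q                          ≡⟨ cong (run s) q≡ ⟩
    run s (suc i + r)                ≡⟨ run-++ s (suc i) r ⟩
    run s (suc i) ++ run (s + suc i) r ≡⟨ cong₂ _++_ (run-snoc s i) (cong (λ z → run z r) (+-suc s i)) ⟩
    (run s i ++ [ suc s + i ]) ++ run (suc s + i) r ≡⟨ ++-assoc (run s i) _ _ ⟩
    run s i ++ suc s + i ∷ run (suc s + i) r ∎)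
  where
  q≡ : q ≡ suc (i + r)
  q≡ = +-cancelˡ-≡ s q (suc (i + r)) (begin
    s + q             ≡⟨ v+r≡s+q ⟨
    suc s + i + r     ≡⟨ cong suc (+-assoc s i r) ⟩
    suc (s + (i + r)) ≡⟨ +-suc s (i + r) ⟨
    s + suc (i + r)   ∎)

run-increasing : ∀ s q → Linked _<_ (run s q)
run-increasing s zero          = []
run-increasing s (suc zero)    = [-]
run-increasing s (suc (suc q)) = n<1+n (suc s) ∷ run-increasing (suc s) (suc q)

pos-head : ∀ v w → pos v (v ∷ w) ≡ 0
pos-head v w with v ≡ᵇ v in eq
... | true  = refl
... | false = ⊥-elim (subst T eq (≡⇒≡ᵇ v v refl))

pos-≢ : ∀ {v x} w → v ≢ x → pos v (x ∷ w) ≡ suc (pos v w)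
pos-≢ {v} {x} w v≢x with v ≡ᵇ x in eq
... | true  = ⊥-elim (v≢x (≡ᵇ⇒≡ v x (subst T (sym eq) _)))
... | false = refl

pos-∉ : ∀ {v} A B → All (v ≢_) A → pos v (A ++ B) ≡ length A + pos v B
pos-∉ []      B []          = refl
pos-∉ (x ∷ A) B (v≢x ∷ v∉A) = trans (pos-≢ (A ++ B) v≢x) (cong suc (pos-∉ A B v∉A))

pos-∈ : ∀ {v} A B → v ∈ A → pos v (A ++ B) < length A
pos-∈ {v} (x ∷ A) B v∈ with v ≟ x
... | yes refl = subst (_< suc (length A)) (sym (pos-head v (A ++ B))) (s≤s z≤n)
pos-∈ (x ∷ A) B (here v≡x)  | no v≢x = ⊥-elim (v≢x v≡x)
pos-∈ (x ∷ A) B (there v∈A) | no v≢x = subst (_< suc (length A)) (sym (pos-≢ (A ++ B) v≢x)) (s≤s (pos-∈ A B v∈A))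

pos-at : ∀ {v} A B → All (v ≢_) A → pos v (A ++ v ∷ B) ≡ length A
pos-at {v} A B v∉A = trans (pos-∉ A (v ∷ B) v∉A) (trans (cong (length A +_) (pos-head v B)) (+-identityʳ _))

pos-run : ∀ s t B {i} → i < t → pos (s + suc i) (run s t ++ B) ≡ i
pos-run s (suc t) B {zero}  _   =
  trans (cong (λ z → pos z (suc s ∷ run (suc s) t ++ B)) (+-comm s 1)) (pos-head (suc s) (run (suc s) t ++ B))
pos-run s (suc t) B {suc i} i<t = begin
  pos (s + suc (suc i)) (suc s ∷ run (suc s) t ++ B) ≡⟨ pos-≢ (run (suc s) t ++ B) s+2+i≢s+1 ⟩
  suc (pos (s + suc (suc i)) (run (suc s) t ++ B))   ≡⟨ cong (λ z → suc (pos z (run (suc s) t ++ B))) (+-suc s (suc i)) ⟩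
  suc (pos (suc s + suc i) (run (suc s) t ++ B))     ≡⟨ cong suc (pos-run (suc s) t B (s≤s⁻¹ i<t)) ⟩
  suc i ∎
  where
  s+2+i≢s+1 : s + suc (suc i) ≢ suc s
  s+2+i≢s+1 eq = <-irrefl (sym eq) (subst (_< s + suc (suc i)) (+-comm s 1) (+-monoʳ-< s (s≤s (s≤s z≤n))))

inv-as-map : ∀ n σ → inv n σ ≡ map (λ v → suc (pos v σ)) (run 0 n)
inv-as-map n σ = applyUpTo-run _ _ 0 n (λ i → refl)

NoDD : List ℕ → Set
NoDD w = ¬ HasDD w

HasDD-++ : ∀ u {w} → HasDD w → HasDD (u ++ w)
HasDD-++ []      dd = dd
HasDD-++ (x ∷ u) dd = there (HasDD-++ u dd)

increasing-NoDD : ∀ {w} → Linked _<_ w → NoDD w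
increasing-NoDD (a<b ∷ _)   (here b<a _) = <-asym a<b b<a
increasing-NoDD (_ ∷ inc)   (there dd)   = increasing-NoDD inc dd
increasing-NoDD [-]         (there ())

-- One letter in front of an increasing word creates at most one descent.
NoDD-cons-increasing : ∀ {x w} → Linked _<_ w → NoDD (x ∷ w)
NoDD-cons-increasing inc (here _ c<b) = <-asym c<b (Linked.head inc)
NoDD-cons-increasing inc (there dd)   = increasing-NoDD inc dd

NoDD-increasing-snoc : ∀ {w y} → Linked _<_ w → NoDD (w ++ [ y ])
NoDD-increasing-snoc []          (there ())
NoDD-increasing-snoc [-]         (there (there ()))
NoDD-increasing-snoc {_ ∷ _ ∷ []}    (a<b ∷ _) (here b<a _) = <-asym a<b b<a
NoDD-increasing-snoc {_ ∷ _ ∷ _ ∷ _} (a<b ∷ _) (here b<a _) = <-asym a<b b<a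
NoDD-increasing-snoc (_ ∷ inc)   (there dd)   = NoDD-increasing-snoc inc dd

-- Concatenating two words without double descents, the first entirely below the second,
-- creates none: the junction is an ascent.
NoDD-++ : ∀ u {v} → NoDD u → NoDD v → All (λ x → All (x <_) v) u → NoDD (u ++ v)
NoDD-++ []                _  nv _              dd             = nv dd
NoDD-++ (x ∷ [])          _  nv _              (there dd)     = nv dd
NoDD-++ (x ∷ [])          _  _  (x<v ∷ [])     (here a<x _)   = <-asym a<x (All.head x<v)
NoDD-++ (x ∷ a ∷ [])      _  _  (_ ∷ a<v ∷ []) (here _ b<a)   = <-asym b<a (All.head a<v)
NoDD-++ (x ∷ a ∷ b ∷ u)   nu _  _              (here b<x c<b) = nu (here b<x c<b)
NoDD-++ (x ∷ u@(_ ∷ _))   nu nv (_ ∷ u<v)      (there dd)     = NoDD-++ u (nu ∘ there) nv u<v dd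

-- Deleting the letters larger than b from  L b b′ M c N , where M lies above b,
-- makes b b′ c adjacent; if b > b′ > c this is a double descent.
dd-after-filter : ∀ L {b b′ c} M N → b′ < b → c < b′ → All (b <_) M →
  HasDD (filter (_≤? b) (L ++ b ∷ b′ ∷ M ++ c ∷ N))
dd-after-filter L {b} {b′} {c} M N b′<b c<b′ M>b =
  subst HasDD (sym filtered) (HasDD-++ (filter (_≤? b) L) (here b′<b c<b′))
  where
  keep : ∀ x → Dec (x ≤ b)
  keep = _≤? b
  filtered : filter keep (L ++ b ∷ b′ ∷ M ++ c ∷ N) ≡ filter keep L ++ b ∷ b′ ∷ c ∷ filter keep N
  filtered = begin
    filter keep (L ++ b ∷ b′ ∷ M ++ c ∷ N)
      ≡⟨ filter-++ keep L _ ⟩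
    filter keep L ++ filter keep (b ∷ b′ ∷ M ++ c ∷ N)
      ≡⟨ cong (filter keep L ++_) (filter-accept keep ≤-refl) ⟩
    filter keep L ++ b ∷ filter keep (b′ ∷ M ++ c ∷ N)
      ≡⟨ cong (λ z → filter keep L ++ b ∷ z) (filter-accept keep (<⇒≤ b′<b)) ⟩
    filter keep L ++ b ∷ b′ ∷ filter keep (M ++ c ∷ N)
      ≡⟨ cong (λ z → filter keep L ++ b ∷ b′ ∷ z) (filter-++ keep M (c ∷ N)) ⟩
    filter keep L ++ b ∷ b′ ∷ filter keep M ++ filter keep (c ∷ N)
      ≡⟨ cong₂ (λ z z′ → filter keep L ++ b ∷ b′ ∷ z ++ z′)
               (filter-none keep (All.map <⇒≱ M>b)) (filter-accept keep (<⇒≤ (<-trans c<b′ b′<b))) ⟩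
    filter keep L ++ b ∷ b′ ∷ c ∷ filter keep N ∎

No231 : List ℕ → Set
No231 w = ¬ Contains231 w

⊆-++⁻ : ∀ (u : List ℕ) {v xs} → xs ⊆ u ++ v → ∃₂ λ ys zs → xs ≡ ys ++ zs × ys ⊆ u × zs ⊆ v
⊆-++⁻ []      τ           = [] , _ , refl , minimum [] , τ
⊆-++⁻ (x ∷ u) (.x ∷ʳ τ)   with ⊆-++⁻ u τ
... | ys , zs , eq , τ₁ , τ₂ = ys , zs , eq , x ∷ʳ τ₁ , τ₂
⊆-++⁻ (x ∷ u) (refl ∷ τ)  with ⊆-++⁻ u τ
... | ys , zs , eq , τ₁ , τ₂ = x ∷ ys , zs , cong (x ∷_) eq , refl ∷ τ₁ , τ₂

⊆-three : ∀ {a b c} {X Y Z : List ℕ} → a ∈ X → b ∈ Y → c ∈ Z → (a ∷ b ∷ c ∷ []) ⊆ X ++ Y ++ Z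
⊆-three a∈ b∈ c∈ = ⊆-++⁺ (from∈ a∈) (⊆-++⁺ (from∈ b∈) (from∈ c∈))

-- A 231 in u ++ v, with u entirely below v, lies inside u or inside v:
-- its "3" cannot come from v while its "2" comes from u.
No231-++ : ∀ {u v} → No231 u → No231 v → All (λ x → All (x <_) v) u → No231 (u ++ v)
No231-++ {u} {v} nu nv u<v (a , b , c , τ , c<a , a<b) = by-split (⊆-++⁻ u τ)
  where
  across : a ∈ u → c ∈ v → ⊥
  across a∈u c∈v = <-asym c<a (All.lookup (All.lookup u<v a∈u) c∈v)
  by-split : ∃₂ (λ ys zs → a ∷ b ∷ c ∷ [] ≡ ys ++ zs × ys ⊆ u × zs ⊆ v) → ⊥
  by-split ([]             , _  , refl , _  , τ₂) = nv (a , b , c , τ₂ , c<a , a<b)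
  by-split (_ ∷ []         , _  , refl , τ₁ , τ₂) = across (to∈ τ₁) (lookup τ₂ (there (here refl)))
  by-split (_ ∷ _ ∷ []     , _  , refl , τ₁ , τ₂) = across (to∈ τ₁) (to∈ τ₂)
  by-split (_ ∷ _ ∷ _ ∷ [] , [] , refl , τ₁ , _ ) = nu (a , b , c , τ₁ , c<a , a<b)

No231-cons-max : ∀ {x w} → No231 w → All (_< x) w → No231 (x ∷ w)
No231-cons-max nw _   (a , b , c , (_ ∷ʳ τ)   , h)        = nw (a , b , c , τ , h)
No231-cons-max nw w<x (a , b , c , (refl ∷ τ) , _ , a<b) = <-asym a<b (All.lookup w<x (to∈ τ))

No231-cons-min : ∀ {x w} → No231 w → All (x <_) w → No231 (x ∷ w)
No231-cons-min nw _   (a , b , c , (_ ∷ʳ τ)   , h)        = nw (a , b , c , τ , h)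
No231-cons-min nw x<w (a , b , c , (refl ∷ τ) , c<a , _) = <-asym c<a (All.lookup x<w (lookup τ (there (here refl))))

No231-run : ∀ s q → No231 (run s q)
No231-run s zero    (_ , _ , _ , () , _)
No231-run s (suc q) = No231-cons-min (No231-run (suc s) q) (All-run (suc s) q (λ s<v _ → s<v))

filter-run : ∀ k s q → filter (_≤? k) (run s q) ≡ run s (q ⊓ (k ∸ s))
filter-run k s zero = refl
filter-run k s (suc q) with suc s ≤? k
... | yes s<k = begin
  filter (_≤? k) (suc s ∷ run (suc s) q)   ≡⟨ filter-accept (_≤? k) s<k ⟩
  suc s ∷ filter (_≤? k) (run (suc s) q)   ≡⟨ cong (suc s ∷_) (filter-run k (suc s) q) ⟩
  run s (suc q ⊓ suc (k ∸ suc s))          ≡⟨ cong (λ z → run s (suc q ⊓ z)) (+-∸-assoc 1 s<k) ⟨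
  run s (suc q ⊓ (k ∸ s))                  ∎
... | no s≮k = begin
  filter (_≤? k) (suc s ∷ run (suc s) q)   ≡⟨ filter-reject (_≤? k) s≮k ⟩
  filter (_≤? k) (run (suc s) q)           ≡⟨ filter-run k (suc s) q ⟩
  run (suc s) (q ⊓ (k ∸ suc s))            ≡⟨ cong (λ z → run (suc s) (q ⊓ z)) (m≤n⇒m∸n≡0 (≤-trans k≤s (n≤1+n s))) ⟩
  run (suc s) (q ⊓ 0)                      ≡⟨ cong (run (suc s)) (⊓-zeroʳ q) ⟩
  []                                       ≡⟨ cong (λ z → run s (suc q ⊓ z)) (m≤n⇒m∸n≡0 k≤s) ⟨
  run s (suc q ⊓ (k ∸ s))                  ∎
  where
  k≤s : k ≤ s
  k≤s = ≤-pred (≰⇒> s≮k)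

cut-length : ∀ {k} s t → k ≤ s + t → k ∸ s ≤ t
cut-length s t k≤s+t = ≤-trans (∸-monoˡ-≤ s k≤s+t) (≤-reflexive (m+n∸m≡n s t))

k<s+1+t⇒k≤s+t : ∀ {k} s t → k < s + suc t → k ≤ s + t
k<s+1+t⇒k≤s+t s t k< = ≤-pred (≤-trans k< (≤-reflexive (+-suc s t)))

-- A block family assigns to an offset s and a length t a
-- word on the letters (s, s+t]; a composition (t₁, …, tⱼ) determines the concatenation of the
-- blocks of lengths t₁, t₂, … at the offsets s, s+t₁, ….  Both ϱ(C) and its inverse are of
-- this form, and the properties below reduce their study to a single block.
module BlockWords (block : ℕ → ℕ → List ℕ)
                  (block-range : ∀ s t → All (λ v → s < v × v ≤ s + t) (block s t)) where

  blocks : ℕ → List ℕ → List ℕ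
  blocks s []      = []
  blocks s (t ∷ C) = block s t ++ blocks (s + t) C

  blocks-above : ∀ s C → All (s <_) (blocks s C)
  blocks-above s []      = []
  blocks-above s (t ∷ C) =
    ++⁺ (All.map proj₁ (block-range s t)) (All.map (≤-<-trans (m≤m+n s t)) (blocks-above (s + t) C))

  block-below-rest : ∀ s t C → All (λ x → All (x <_) (blocks (s + t) C)) (block s t)
  block-below-rest s t C = All.map (λ x-range → All.map (≤-<-trans (proj₂ x-range)) (blocks-above (s + t) C)) (block-range s t)

  blocks-NoDD : (∀ s t → NoDD (block s t)) → ∀ s C → NoDD (blocks s C)
  blocks-NoDD block-NoDD s []      ()
  blocks-NoDD block-NoDD s (t ∷ C) =
    NoDD-++ (block s t) (block-NoDD s t) (blocks-NoDD block-NoDD (s + t) C) (block-below-rest s t C)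

  blocks-No231 : (∀ s t → No231 (block s t)) → ∀ s C → No231 (blocks s C)
  blocks-No231 block-No231 s []      (_ , _ , _ , () , _)
  blocks-No231 block-No231 s (t ∷ C) =
    No231-++ (block-No231 s t) (blocks-No231 block-No231 (s + t) C) (block-below-rest s t C)

  blocks-perm : (∀ s t → block s t ↭ run s t) → ∀ s C → blocks s C ↭ run s (sum C)
  blocks-perm block-perm s []      = ↭-reflexive refl
  blocks-perm block-perm s (t ∷ C) =
    ↭-trans (↭-++⁺ (block-perm s t) (blocks-perm block-perm (s + t) C)) (↭-reflexive (sym (run-++ s t (sum C))))

  -- If cutting a single block at height k always gives a block word, so does cutting any block
  -- word: blocks entirely ≤ k survive, blocks entirely above k vanish, one block is cut.
  blocks-filter : (∀ k s t → k < s + t → ∃[ C ] filter (_≤? k) (block s t) ≡ blocks s C) →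
                  ∀ k s C → ∃[ C′ ] filter (_≤? k) (blocks s C) ≡ blocks s C′
  blocks-filter block-filter k s []      = [] , refl
  blocks-filter block-filter k s (t ∷ C) with s + t ≤? k
  ... | yes s+t≤k =
    let C′ , rest≡ = blocks-filter block-filter k (s + t) C in
    t ∷ C′ , (begin
      filter (_≤? k) (block s t ++ blocks (s + t) C)                 ≡⟨ filter-++ (_≤? k) (block s t) _ ⟩
      filter (_≤? k) (block s t) ++ filter (_≤? k) (blocks (s + t) C) ≡⟨ cong₂ _++_ (filter-all (_≤? k) kept) rest≡ ⟩
      block s t ++ blocks (s + t) C′                                 ∎)
    where
    kept : All (_≤ k) (block s t)
    kept = All.map (λ x-range → ≤-trans (proj₂ x-range) s+t≤k) (block-range s t)
  ... | no s+t≰k =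
    let C′ , block≡ = block-filter k s t (≰⇒> s+t≰k) in
    C′ , (begin
      filter (_≤? k) (block s t ++ blocks (s + t) C)                 ≡⟨ filter-++ (_≤? k) (block s t) _ ⟩
      filter (_≤? k) (block s t) ++ filter (_≤? k) (blocks (s + t) C) ≡⟨ cong₂ _++_ block≡ (filter-none (_≤? k) dropped) ⟩
      blocks s C′ ++ []                                              ≡⟨ ++-identityʳ _ ⟩
      blocks s C′                                                    ∎)
    where
    dropped : All (λ x → ¬ x ≤ k) (blocks (s + t) C)
    dropped = All.map (λ s+t<x x≤k → <⇒≱ (<-≤-trans (≰⇒> s+t≰k) (<⇒≤ s+t<x)) x≤k) (blocks-above (s + t) C)

  blocks-simsun : (∀ s t → NoDD (block s t)) →
                  (∀ k s t → k < s + t → ∃[ C ] filter (_≤? k) (block s t) ≡ blocks s C) →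
                  ∀ s C → Simsun (blocks s C)
  blocks-simsun block-NoDD block-filter s C k dd =
    let C′ , filtered≡ = blocks-filter block-filter k s C in
    blocks-NoDD block-NoDD s C′ (subst HasDD filtered≡ dd)

blockBar-run : ∀ s t → blockBar s (suc t) ≡ s + suc t ∷ run s t
blockBar-run s t = cong (s + suc t ∷_) (trans (applyUpTo-run _ (λ v → v) s t (λ i → refl)) (map-id (run s t)))

s<s+1+t : ∀ s t → s < s + suc t
s<s+1+t s t = m<m+n s (s≤s z≤n)

blockBar-range : ∀ s t → All (λ v → s < v × v ≤ s + t) (blockBar s t)
blockBar-range s zero    = []
blockBar-range s (suc t) rewrite blockBar-run s t =
  (s<s+1+t s t , ≤-refl) ∷ All-run s t (λ s<v v≤s+t → s<v , ≤-trans v≤s+t (+-monoʳ-≤ s (n≤1+n t)))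

module ϱBlocks = BlockWords blockBar blockBar-range

ϱ-from-blocks : ∀ s C → ϱ-from s C ≡ ϱBlocks.blocks s C
ϱ-from-blocks s []      = refl
ϱ-from-blocks s (t ∷ C) = cong (blockBar s t ++_) (ϱ-from-blocks (s + t) C)

-- μ̄ has no double descent and avoids 231: it is its maximum followed by an increasing run.
blockBar-NoDD : ∀ s t → NoDD (blockBar s t)
blockBar-NoDD s (suc t) rewrite blockBar-run s t = NoDD-cons-increasing (run-increasing s t)

blockBar-No231 : ∀ s t → No231 (blockBar s t)
blockBar-No231 s zero    (_ , _ , _ , () , _)
blockBar-No231 s (suc t) rewrite blockBar-run s t =
  No231-cons-max (No231-run s t) (All-run s t (λ _ v≤s+t → ≤-<-trans v≤s+t (+-monoʳ-< s (n<1+n t))))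

blockBar-perm : ∀ s t → blockBar s t ↭ run s t
blockBar-perm s zero    = ↭-reflexive refl
blockBar-perm s (suc t) rewrite blockBar-run s t =
  ↭-trans (∷↭∷ʳ (s + suc t) (run s t))
          (↭-reflexive (sym (trans (run-snoc s t) (cong (λ z → run s t ++ [ z ]) (sym (+-suc s t))))))

blocks-ones : ∀ s j → ϱBlocks.blocks s (replicate j 1) ≡ run s j
blocks-ones s zero    = refl
blocks-ones s (suc j) rewrite +-comm s 1 = cong (suc s ∷_) (blocks-ones (suc s) j)

-- Cutting μ̄ below its first letter leaves an increasing run, i.e. blocks of length 1.
blockBar-filter : ∀ k s t → k < s + t → ∃[ C ] filter (_≤? k) (blockBar s t) ≡ ϱBlocks.blocks s C
blockBar-filter k s zero    _ = [] , refl
blockBar-filter k s (suc t) k< = replicate (k ∸ s) 1 , (begin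
  filter (_≤? k) (blockBar s (suc t))        ≡⟨ cong (filter (_≤? k)) (blockBar-run s t) ⟩
  filter (_≤? k) (s + suc t ∷ run s t)       ≡⟨ filter-reject (_≤? k) (<⇒≱ k<) ⟩
  filter (_≤? k) (run s t)                   ≡⟨ filter-run k s t ⟩
  run s (t ⊓ (k ∸ s))                        ≡⟨ cong (run s) (m≥n⇒m⊓n≡n (cut-length s t (k<s+1+t⇒k≤s+t s t k<))) ⟩
  run s (k ∸ s)                              ≡⟨ blocks-ones s (k ∸ s) ⟨
  ϱBlocks.blocks s (replicate (k ∸ s) 1)     ∎)

-- The inverse block (s+2) (s+3) … (s+t) (s+1) of μ̄.
ψ-block : ℕ → ℕ → List ℕ
ψ-block s zero    = []
ψ-block s (suc t) = run (suc s) t ++ [ suc s ]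

ψ-block-range : ∀ s t → All (λ v → s < v × v ≤ s + t) (ψ-block s t)
ψ-block-range s zero    = []
ψ-block-range s (suc t) =
  ++⁺ (All-run (suc s) t (λ s<v v≤ → <-trans (n<1+n s) s<v , ≤-trans v≤ (≤-reflexive (sym (+-suc s t)))))
      ((n<1+n s , ≤-trans (s≤s (m≤m+n s t)) (≤-reflexive (sym (+-suc s t)))) ∷ [])

module ψBlocks = BlockWords ψ-block ψ-block-range

-- The word that will turn out to be ϱ(C)⁻¹.
ψ : List ℕ → List ℕ
ψ C = ψBlocks.blocks 0 C

ψ-block-NoDD : ∀ s t → NoDD (ψ-block s t)
ψ-block-NoDD s (suc t) = NoDD-increasing-snoc (run-increasing (suc s) t)

ψ-block-filter : ∀ k s t → k < s + t → ∃[ C ] filter (_≤? k) (ψ-block s t) ≡ ψBlocks.blocks s C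
ψ-block-filter k s zero    _ = [] , refl
ψ-block-filter k s (suc t) k< with suc s ≤? k
... | yes s<k = suc (k ∸ suc s) ∷ [] , (begin
  filter (_≤? k) (run (suc s) t ++ [ suc s ])                        ≡⟨ filter-++ (_≤? k) (run (suc s) t) _ ⟩
  filter (_≤? k) (run (suc s) t) ++ filter (_≤? k) [ suc s ]         ≡⟨ cong₂ _++_ (filter-run k (suc s) t) (filter-accept (_≤? k) s<k) ⟩
  run (suc s) (t ⊓ (k ∸ suc s)) ++ [ suc s ]                         ≡⟨ cong (λ z → run (suc s) z ++ [ suc s ]) (m≥n⇒m⊓n≡n (cut-length (suc s) t (≤-trans (k<s+1+t⇒k≤s+t s t k<) (n≤1+n _)))) ⟩
  ψ-block s (suc (k ∸ suc s))                                        ≡⟨ ++-identityʳ _ ⟨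
  ψBlocks.blocks s (suc (k ∸ suc s) ∷ [])                            ∎)
... | no s≮k = [] , (begin
  filter (_≤? k) (run (suc s) t ++ [ suc s ])                        ≡⟨ filter-++ (_≤? k) (run (suc s) t) _ ⟩
  filter (_≤? k) (run (suc s) t) ++ filter (_≤? k) [ suc s ]         ≡⟨ cong₂ _++_ (filter-run k (suc s) t) (filter-reject (_≤? k) s≮k) ⟩
  run (suc s) (t ⊓ (k ∸ suc s)) ++ []                                ≡⟨ cong (λ z → run (suc s) (t ⊓ z) ++ []) (m≤n⇒m∸n≡0 (<⇒≤ (≰⇒> s≮k))) ⟩
  run (suc s) (t ⊓ 0) ++ []                                          ≡⟨ cong (λ z → run (suc s) z ++ []) (⊓-zeroʳ t) ⟩
  []                                                                 ∎)

map-run : ∀ (f : ℕ → ℕ) s s′ q → (∀ {i} → i < q → f (s + suc i) ≡ s′ + suc i) → map f (run s q) ≡ run s′ q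
map-run f s s′ zero    _       = refl
map-run f s s′ (suc q) f-shift =
  cong₂ _∷_ (trans (cong f (+-comm 1 s)) (trans (f-shift (s≤s z≤n)) (+-comm s′ 1)))
            (map-run f (suc s) (suc s′) q (λ {i} i<q →
               trans (cong f (sym (+-suc s (suc i)))) (trans (f-shift (s≤s i<q)) (+-suc s′ (suc i)))))

-- For the block μ̄ at offset s, the letter s+1+i
-- (i < t) sits at relative position i+1 and the letter s+t+1 at relative position 0.
inv-blocks : ∀ s C → map (λ v → s + suc (pos v (ϱ-from s C))) (run s (sum C)) ≡ ψBlocks.blocks s C
inv-blocks s []          = refl
inv-blocks s (zero ∷ C)  rewrite +-identityʳ s = inv-blocks s C
inv-blocks s (suc t ∷ C) = begin
  map G (run s (suc t + sum C))                    ≡⟨ cong (map G) (run-++ s (suc t) (sum C)) ⟩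
  map G (run s (suc t) ++ run M (sum C))           ≡⟨ map-++ G (run s (suc t)) _ ⟩
  map G (run s (suc t)) ++ map G (run M (sum C))   ≡⟨ cong₂ _++_ first-block later-blocks ⟩
  ψ-block s (suc t) ++ ψBlocks.blocks M C          ∎
  where
  M : ℕ
  M = s + suc t
  R : List ℕ
  R = ϱ-from M C
  G : ℕ → ℕ
  G v = s + suc (pos v (ϱ-from s (suc t ∷ C)))
  ϱ≡ : ϱ-from s (suc t ∷ C) ≡ M ∷ run s t ++ R
  ϱ≡ = cong (_++ R) (blockBar-run s t)

  G-run : ∀ {i} → i < t → G (s + suc i) ≡ suc s + suc i
  G-run {i} i<t = begin
    s + suc (pos (s + suc i) (ϱ-from s (suc t ∷ C)))  ≡⟨ cong (λ w → s + suc (pos (s + suc i) w)) ϱ≡ ⟩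
    s + suc (pos (s + suc i) (M ∷ run s t ++ R))      ≡⟨ cong (λ p → s + suc p) (pos-≢ (run s t ++ R) (λ eq → <-irrefl eq (+-monoʳ-< s (s≤s i<t)))) ⟩
    s + suc (suc (pos (s + suc i) (run s t ++ R)))    ≡⟨ cong (λ p → s + suc (suc p)) (pos-run s t R i<t) ⟩
    s + suc (suc i)                                   ≡⟨ +-suc s (suc i) ⟩
    suc s + suc i                                     ∎

  G-top : G (suc (s + t)) ≡ suc s
  G-top = begin
    s + suc (pos (suc (s + t)) (ϱ-from s (suc t ∷ C))) ≡⟨ cong (λ v → s + suc (pos v (ϱ-from s (suc t ∷ C)))) (sym (+-suc s t)) ⟩
    s + suc (pos M (ϱ-from s (suc t ∷ C)))             ≡⟨ cong (λ w → s + suc (pos M w)) ϱ≡ ⟩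
    s + suc (pos M (M ∷ run s t ++ R))                 ≡⟨ cong (λ p → s + suc p) (pos-head M (run s t ++ R)) ⟩
    s + 1                                              ≡⟨ +-comm s 1 ⟩
    suc s                                              ∎

  first-block : map G (run s (suc t)) ≡ ψ-block s (suc t)
  first-block = begin
    map G (run s (suc t))                   ≡⟨ cong (map G) (run-snoc s t) ⟩
    map G (run s t ++ [ suc (s + t) ])      ≡⟨ map-++ G (run s t) _ ⟩
    map G (run s t) ++ [ G (suc (s + t)) ]  ≡⟨ cong₂ (λ u x → u ++ [ x ]) (map-run G s (suc s) t G-run) G-top ⟩
    run (suc s) t ++ [ suc s ]              ∎

  G-later : ∀ {v} → M < v → v ≤ M + sum C → G v ≡ M + suc (pos v R)
  G-later {v} M<v _ = begin
    s + suc (pos v (ϱ-from s (suc t ∷ C)))  ≡⟨ cong (λ w → s + suc (pos v w)) ϱ≡ ⟩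
    s + suc (pos v ((M ∷ run s t) ++ R))    ≡⟨ cong (λ p → s + suc p) (pos-∉ (M ∷ run s t) R v∉block) ⟩
    s + suc (suc (length (run s t)) + pos v R) ≡⟨ cong (λ l → s + suc (suc l + pos v R)) (length-run s t) ⟩
    s + suc (suc t + pos v R)               ≡⟨ cong (λ p → s + suc p) (+-suc t (pos v R)) ⟨
    s + (suc t + suc (pos v R))             ≡⟨ +-assoc s (suc t) (suc (pos v R)) ⟨
    M + suc (pos v R)                       ∎
    where
    v∉block : All (v ≢_) (M ∷ run s t)
    v∉block = (λ eq → <-irrefl (sym eq) M<v)
            ∷ All-run s t (λ _ x≤s+t eq → <-irrefl (sym eq) (≤-<-trans x≤s+t (<-trans (+-monoʳ-< s (n<1+n t)) M<v)))

  later-blocks : map G (run M (sum C)) ≡ ψBlocks.blocks M C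
  later-blocks = trans (map-cong-local (All-run M (sum C) G-later)) (inv-blocks M C)

inv-ϱ : ∀ C → inv (sum C) (ϱ C) ≡ ψ C
inv-ϱ C = trans (inv-as-map (sum C) (ϱ C)) (inv-blocks 0 C)

ϱ-in-DRS : ∀ {n} C → IsComposition n C → DRS231 n (ϱ C)
ϱ-in-DRS C (_ , refl) = permutation , simsun , avoids-231 , inverse-simsun
  where
  permutation : IsPerm (sum C) (ϱ C)
  permutation = ↭-trans (↭-reflexive (ϱ-from-blocks 0 C))
                (↭-trans (ϱBlocks.blocks-perm blockBar-perm 0 C) (↭-reflexive (sym ([1‥n]≡run (sum C)))))
  simsun : Simsun (ϱ C)
  simsun = subst Simsun (sym (ϱ-from-blocks 0 C)) (ϱBlocks.blocks-simsun blockBar-NoDD blockBar-filter 0 C)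
  avoids-231 : No231 (ϱ C)
  avoids-231 = subst No231 (sym (ϱ-from-blocks 0 C)) (ϱBlocks.blocks-No231 blockBar-No231 0 C)
  inverse-simsun : Simsun (inv (sum C) (ϱ C))
  inverse-simsun = subst Simsun (sym (inv-ϱ C)) (ψBlocks.blocks-simsun ψ-block-NoDD ψ-block-filter 0 C)

-- ϱ is injective on compositions: the first letter s+t of ϱ-from s C determines the first part t.
ϱ-from-injective : ∀ s {C D} → All (0 <_) C → All (0 <_) D → ϱ-from s C ≡ ϱ-from s D → C ≡ D
ϱ-from-injective s []                []                _  = refl
ϱ-from-injective s []                (s≤s z≤n ∷ _)     ()
ϱ-from-injective s (s≤s z≤n ∷ _)     []                ()
ϱ-from-injective s {suc t ∷ C} {suc u ∷ D} (_ ∷ C⁺) (_ ∷ D⁺) eq with ∷-injective eq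
... | first≡ , rest≡ with suc-injective (+-cancelˡ-≡ s (suc t) (suc u) first≡)
... | refl = cong (suc t ∷_) (ϱ-from-injective (s + suc t) C⁺ D⁺ (++-cancelˡ (applyUpTo (λ i → s + suc i) t) _ _ rest≡))

run-around : ∀ {n y m} → 1 ≤ y → suc y < m → m ≤ n →
  ∃[ L ] ∃[ M ] ∃[ N ] (run 0 n ≡ L ++ y ∷ suc y ∷ M ++ m ∷ N × All (λ v → suc y < v × v < m) M)
run-around {n} {y} {m} 1≤y y+1<m m≤n
  with run-split 0 n (∈-run⁺ 0 n 1≤y (≤-trans (<⇒≤ (<-trans (n<1+n y) y+1<m)) m≤n))
... | i , r , y≡ , n≡ , split-y
  with run-split y r (∈-run⁺ y r (<-trans (n<1+n y) y+1<m) (≤-trans m≤n (≤-reflexive (sym y+r≡n))))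
  where
  y+r≡n : y + r ≡ n
  y+r≡n = trans (cong (_+ r) y≡) (sym n≡)
... | zero , r′ , m≡ , _ , _ = ⊥-elim (<-irrefl (trans (+-comm 1 y) (sym m≡)) y+1<m)
... | suc j , r′ , m≡ , _ , split-m =
  run 0 i , run (suc y) j , run m r′ , trans split-y (cong (λ w → run 0 i ++ y ∷ w) split-m) ,
  All-run (suc y) j (λ y+1<v v≤ → y+1<v , ≤-<-trans v≤ (subst (suc y + j <_) (sym m≡) y+1+j<m))
  where
  y+1+j<m : suc y + j < y + suc (suc j)
  y+1+j<m = subst (_< y + suc (suc j)) (+-suc y j) (+-monoʳ-< y (n<1+n (suc j)))

first-occurrence : ∀ {y : ℕ} {u} → y ∈ u → ∃₂ λ V W → u ≡ V ++ y ∷ W × All (y ≢_) V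
first-occurrence {y} {x ∷ u} y∈ with y ≟ x
... | yes refl = [] , u , refl , []
first-occurrence (here y≡x)  | no y≢x = ⊥-elim (y≢x y≡x)
first-occurrence (there y∈u) | no y≢x with first-occurrence y∈u
... | V , W , u≡ , y∉V = _ ∷ V , W , cong (_ ∷_) u≡ , y≢x ∷ y∉V

apart : ∀ {v x} → x < v ⊎ v < x → v ≢ x
apart (inj₁ x<v) refl = <-irrefl refl x<v
apart (inj₂ v<x) refl = <-irrefl refl v<x

module Surjectivity {n : ℕ} {σ : List ℕ} (avoids : No231 σ) (inv-simsun : Simsun (inv n σ)) where

  F : ℕ → ℕ
  F v = suc (pos v σ)

  -- If σ⁻¹(m) < σ⁻¹(y+1) < σ⁻¹(y) while every letter strictly between y+1 and m comes after y,
  -- then cutting σ⁻¹ at σ⁻¹(y) leaves the double descent σ⁻¹(y) σ⁻¹(y+1) σ⁻¹(m).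
  inverse-descent : ∀ {y m} → 1 ≤ y → suc y < m → m ≤ n →
    F m < F (suc y) → F (suc y) < F y → (∀ {v} → suc y < v → v < m → F y < F v) → ⊥
  inverse-descent {y} {m} 1≤y y+1<m m≤n Fm<Fy+1 Fy+1<Fy between with run-around 1≤y y+1<m m≤n
  ... | L , M , N , run≡ , M-between =
    inv-simsun (F y) (subst (λ w → HasDD (filter (_≤? F y) w)) (sym inv≡)
      (dd-after-filter (map F L) (map F M) (map F N) Fy+1<Fy Fm<Fy+1
        (map⁺ (All.map (λ v-between → between (proj₁ v-between) (proj₂ v-between)) M-between))))
    where
    inv≡ : inv n σ ≡ map F L ++ F y ∷ F (suc y) ∷ map F M ++ F m ∷ map F N
    inv≡ = begin
      inv n σ                                                ≡⟨ inv-as-map n σ ⟩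
      map F (run 0 n)                                        ≡⟨ cong (map F) run≡ ⟩
      map F (L ++ y ∷ suc y ∷ M ++ m ∷ N)                    ≡⟨ map-++ F L _ ⟩
      map F L ++ F y ∷ F (suc y) ∷ map F (M ++ m ∷ N)        ≡⟨ cong (λ w → map F L ++ F y ∷ F (suc y) ∷ w) (map-++ F M _) ⟩
      map F L ++ F y ∷ F (suc y) ∷ map F M ++ F m ∷ map F N  ∎

  -- Suppose σ = P (y+1) u with y occurring in u, where no letter of
  -- P lies in [y, m) and m is one of them.  Avoiding 231 forces every letter between y+1 and y
  -- to be ≤ y+1, so the letters strictly between y+1 and m all come after y: inverse-descent.
  no-skipped-descent : ∀ {P u y m} → σ ≡ P ++ suc y ∷ u → y ∈ u → m ∈ P →
    All (λ v → v < y ⊎ m ≤ v) P → 1 ≤ y → suc y < m → m ≤ n → ⊥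
  no-skipped-descent {P} {u} {y} {m} σ≡ y∈u m∈P P-outside 1≤y y+1<m m≤n with first-occurrence y∈u
  ... | V , W , u≡ , y∉V = inverse-descent 1≤y y+1<m m≤n Fm<Fy+1 Fy+1<Fy Fy<F-between
    where
    A : List ℕ
    A = P ++ suc y ∷ V
    σ≡P : σ ≡ P ++ suc y ∷ V ++ y ∷ W
    σ≡P = trans σ≡ (cong (λ z → P ++ suc y ∷ z) u≡)
    σ≡A : σ ≡ A ++ y ∷ W
    σ≡A = trans σ≡P (sym (++-assoc P (suc y ∷ V) (y ∷ W)))

    -- Between y+1 and y only letters ≤ y+1 occur, else (y+1) b y would be a 231.
    V-low : All (_≤ suc y) V
    V-low = All.tabulate (λ b∈V → ≮⇒≥ (λ y+1<b →
      avoids (suc y , _ , y ,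
              subst (_ ⊆_) (sym σ≡P) (⊆-++ˡ P (⊆-three {X = [ suc y ]} {Z = y ∷ W} (here refl) b∈V (here refl))) ,
              n<1+n y , y+1<b)))

    P-below : ∀ {v} → y ≤ v → v < m → All (v ≢_) P
    P-below y≤v v<m = All.map (λ { (inj₁ x<y) → apart (inj₁ (<-≤-trans x<y y≤v))
                                 ; (inj₂ m≤x) → apart (inj₂ (<-≤-trans v<m m≤x)) }) P-outside

    pos-m : pos m σ < length P
    pos-m = subst (λ w → pos m w < length P) (sym σ≡) (pos-∈ P (suc y ∷ u) m∈P)

    pos-y+1 : pos (suc y) σ ≡ length P
    pos-y+1 = trans (cong (pos (suc y)) σ≡) (pos-at P u (P-below (n≤1+n y) y+1<m))

    pos-y : pos y σ ≡ length A
    pos-y = trans (cong (pos y) σ≡A)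
      (pos-at A W (++⁺ (P-below ≤-refl (<-trans (n<1+n y) y+1<m)) (apart (inj₂ (n<1+n y)) ∷ y∉V)))

    pos-between : ∀ {v} → suc y < v → v < m → suc (length A) ≤ pos v σ
    pos-between {v} y+1<v v<m =
      subst (suc (length A) ≤_) (sym pos-v)
        (≤-trans (≤-reflexive (trans (+-comm 1 (length A)) (sym (length-++ A)))) (m≤m+n _ (pos v W)))
      where
      y<v : y < v
      y<v = <-trans (n<1+n y) y+1<v
      v∉ : All (v ≢_) (A ++ [ y ])
      v∉ = ++⁺ (++⁺ (P-below (<⇒≤ y<v) v<m)
                    (apart (inj₁ y+1<v) ∷ All.map (λ b≤y+1 → apart (inj₁ (≤-<-trans b≤y+1 y+1<v))) V-low))
               (apart (inj₁ y<v) ∷ [])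
      pos-v : pos v σ ≡ length (A ++ [ y ]) + pos v W
      pos-v = trans (cong (pos v) (trans σ≡A (sym (++-assoc A [ y ] W)))) (pos-∉ (A ++ [ y ]) W v∉)

    Fm<Fy+1 : F m < F (suc y)
    Fm<Fy+1 = s≤s (subst (pos m σ <_) (sym pos-y+1) pos-m)

    Fy+1<Fy : F (suc y) < F y
    Fy+1<Fy = s≤s (subst₂ _<_ (sym pos-y+1) (sym pos-y)
      (subst (length P <_) (sym (length-++ P)) (m<m+n (length P) (s≤s z≤n))))

    Fy<F-between : ∀ {v} → suc y < v → v < m → F y < F v
    Fy<F-between y+1<v v<m = s≤s (subst (_< pos _ σ) (sym pos-y) (pos-between y+1<v v<m))

  -- Right after the first letter m of a block, the letters s+1, …, m−1 follow in increasing
  -- order.  Invariant: σ = Q u, where Q contains m and no letter of (s, m), and u rearranges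
  -- the run s+1, …, s+d ending just below m, followed by letters above m.  The next letter x of u
  -- must be s+1: if x > m then m x (s+1) is a 231, and if s+1 < x < m then x = y+1 with y later.
  ascending-run : ∀ d {s m Q u B} → suc (s + d) ≡ m → m ≤ n → σ ≡ Q ++ u → m ∈ Q →
    All (λ v → v ≤ s ⊎ m ≤ v) Q → All (m <_) B → u ↭ run s d ++ B →
    ∃[ w ] (u ≡ run s d ++ w × w ↭ B)
  ascending-run zero _ _ _ _ _ _ u↭B = _ , refl , u↭B
  ascending-run (suc d) {u = []} _ _ _ _ _ _ u↭ with ↭-length u↭
  ... | ()
  ascending-run (suc d) {s} {m} {Q} {x ∷ u} {B} m≡ m≤n σ≡ m∈Q Q-outside B-above u↭
    with x ≟ suc s | ∈-++⁻ (run s (suc d)) (∈-resp-↭ u↭ (here refl))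
  ... | yes refl | _ =
    let w , u≡ , w↭B = ascending-run d (trans (cong suc (sym (+-suc s d))) m≡) m≤n
                         (trans σ≡ (sym (++-assoc Q [ suc s ] u))) (∈-++⁺ˡ m∈Q)
                         (++⁺ (All.map (map₁ (λ v≤s → ≤-trans v≤s (n≤1+n s))) Q-outside) (inj₁ ≤-refl ∷ []))
                         B-above (drop-∷ u↭)
    in w , cong (suc s ∷_) u≡ , w↭B
  ... | no x≢s+1 | inj₂ x∈B = ⊥-elim (
    avoids (m , x , suc s , subst (_ ⊆_) (sym σ≡) (⊆-three {Y = [ x ]} m∈Q (here refl) s+1∈u) ,
            s+1<m , All.lookup B-above x∈B))
    where
    s+1∈u : suc s ∈ u
    s+1∈u with ∈-resp-↭ (↭-sym u↭) (here refl)
    ... | here s+1≡x    = ⊥-elim (x≢s+1 (sym s+1≡x))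
    ... | there s+1∈u′ = s+1∈u′
    s+1<m : suc s < m
    s+1<m = subst (suc s <_) m≡ (s≤s (s<s+1+t s d))
  ... | no x≢s+1 | inj₁ x∈run with ∈-run⁻ s (suc d) x∈run
  ... | s≤s {n = y} s≤y , x≤s+1+d = ⊥-elim (
    no-skipped-descent σ≡ y∈u m∈Q
      (All.map (map₁ (λ v≤s → ≤-<-trans v≤s s<y)) Q-outside)
      (≤-trans (s≤s z≤n) s<y) (<-≤-trans (s≤s x≤s+1+d) (≤-reflexive m≡)) m≤n)
    where
    s<y : s < y
    s<y = ≤∧≢⇒< s≤y (λ s≡y → x≢s+1 (cong suc (sym s≡y)))
    y∈u : y ∈ u
    y∈u with ∈-resp-↭ (↭-sym u↭) (∈-++⁺ˡ (∈-run⁺ s (suc d) s<y (≤-trans (n≤1+n y) x≤s+1+d)))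
    ... | here y≡y+1 = ⊥-elim (<-irrefl y≡y+1 (n<1+n y))
    ... | there y∈u′ = y∈u′

  Decomposable : ℕ → Set
  Decomposable p = ∀ {s pre w} → s + p ≡ n → σ ≡ pre ++ w → All (_≤ s) pre → w ↭ run s p →
    ∃[ C ] (All (0 <_) C × sum C ≡ p × ϱ-from s C ≡ w)

  -- Peeling off blocks: the first letter M = s+t+1 of w starts a block, ascending-run shows it is
  -- followed by s+1, …, s+t, i.e. w begins with μ̄, and the rest is decomposed recursively.
  decompose : ∀ p → Decomposable p
  decompose = <-rec Decomposable peel
    where
    peel : ∀ p → (∀ {p′} → p′ < p → Decomposable p′) → Decomposable p
    peel p _ {s} {pre} {[]} _ _ _ w↭ =
      [] , [] , trans (↭-length w↭) (length-run s p) , refl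
    peel p rec {s} {pre} {m ∷ w′} s+p≡n σ≡ pre≤s w↭ with run-split s p (∈-resp-↭ w↭ (here refl))
    ... | t , p′ , refl , refl , run≡ =
      let w″ , w′≡ , w″↭ = ascending-run t (sym (+-suc s t)) M≤n
                             (trans σ≡ (sym (++-assoc pre [ M ] w′))) (∈-++⁺ʳ pre (here refl))
                             (++⁺ (All.map inj₁ pre≤s) (inj₂ ≤-refl ∷ []))
                             (All-run M p′ (λ M<v _ → M<v))
                             (drop-mid [] (run s t) (↭-trans w↭ (↭-reflexive run≡)))
          C , C⁺ , ΣC≡ , ϱ≡ = rec (s≤s (m≤n+m p′ t)) (trans (+-assoc s (suc t) p′) s+p≡n)
                                (trans σ≡ (trans (cong (λ z → pre ++ M ∷ z) w′≡) (sym (++-assoc pre (M ∷ run s t) w″))))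
                                pre-block≤M w″↭
      in suc t ∷ C , s≤s z≤n ∷ C⁺ , cong (suc ∘ (t +_)) ΣC≡ ,
         trans (cong₂ _++_ (blockBar-run s t) ϱ≡) (cong (M ∷_) (sym w′≡))
      where
      M : ℕ
      M = s + suc t
      M≤n : M ≤ n
      M≤n = ≤-trans (+-monoʳ-≤ s (s≤s (m≤m+n t p′))) (≤-reflexive s+p≡n)
      pre-block≤M : All (_≤ M) (pre ++ M ∷ run s t)
      pre-block≤M = ++⁺ (All.map (λ v≤s → ≤-trans v≤s (m≤m+n s (suc t))) pre≤s)
                        (≤-refl ∷ All-run s t (λ _ v≤s+t → ≤-trans v≤s+t (+-monoʳ-≤ s (n≤1+n t))))

ϱ-surjective : ∀ {n σ} → DRS231 n σ → ∃[ C ] (IsComposition n C × ϱ C ≡ σ)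
ϱ-surjective {n} (perm , _ , avoids , inv-simsun) =
  let C , C⁺ , ΣC≡ , ϱ≡ = Surjectivity.decompose avoids inv-simsun n refl refl []
                            (↭-trans perm (↭-reflexive ([1‥n]≡run n)))
  in C , (C⁺ , ΣC≡) , ϱ≡

proposition4p7 : (n : ℕ) → 1 ≤ n →
    ((C : List ℕ) → IsComposition n C → DRS231 n (ϱ C))
    × ((C D : List ℕ) → IsComposition n C → IsComposition n D → ϱ C ≡ ϱ D → C ≡ D)
    × ((σ : List ℕ) → DRS231 n σ → ∃[ C ] (IsComposition n C × ϱ C ≡ σ))
proposition4p7 n _ =
  ϱ-in-DRS ,
  (λ C D (C⁺ , _) (D⁺ , _) → ϱ-from-injective 0 C⁺ D⁺) ,
  (λ σ → ϱ-surjective)
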